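{- In $\mathsf{ZF}$, the following are equivalent: (1) given a sequence of sets $(A_n)_{n\in\mathbb{N}}$ and a sequence of injections $f_n : A_{n+1}\to A_n$, there is $n\in\mathbb{N}$ such that there is a bijection between $A_n$ and $A_{n+1}$; (2) given a sequence of sets $B_0\supseteq B_1\supseteq B_2\supseteq\cdots$, there is $n\in\mathbb{N}$ such that there is a bijection between $B_n$ and $B_{n+1}$. -}

module Defs where

open import Level using (Level; suc)
open import Data.Nat using (ℕ) renaming (suc to sucℕ)
open import Data.Product using (Σ; ∃-syntax)
open import Function.Bundles using (_↣_; _⤖_)
open import Relation.Unary using (Pred; _⊆_)
open import Relation.Nullary using (Irrelevant)

-- "Sets" are types in the universe Set ℓ; subsets of X are proof-irrelevant
-- predicates on X; the subset B as a set is the Σ-type Σ X B.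

Principle1 : (ℓ : Level) → Set (suc ℓ)
Principle1 ℓ =
  (A : ℕ → Set ℓ) → ((n : ℕ) → A (sucℕ n) ↣ A n) →
  ∃[ n ] (A n ⤖ A (sucℕ n))

Principle2 : (ℓ : Level) → Set (suc ℓ)
Principle2 ℓ =
  (X : Set ℓ) (B : ℕ → Pred X ℓ) →
  ((n : ℕ) (x : X) → Irrelevant (B n x)) →
  ((n : ℕ) → B (sucℕ n) ⊆ B n) →
  ∃[ n ] (Σ X (B n) ⤖ Σ X (B (sucℕ n)))

-- Inclusions of subsets are injections, so (1) gives (2).  Conversely, composing
-- the injections embeds every A n into A 0; the images of these embeddings
-- form a decreasing sequence of subsets of A 0, each in bijection with its A n,
-- so a bijection between consecutive images given by (2) transfers back.

module Submission where

open import Defs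
open import Level using (Level; _⊔_)
open import Function.Base using (_∘_)
open import Function.Bundles using (_⇔_; _↣_; _⤖_; mk↣; mk⇔; mk↔ₛ′; Injection)
open import Function.Properties.Inverse using (↔⇒⤖)
open import Function.Construct.Composition using (_↣-∘_; _⤖-∘_)
open import Function.Construct.Identity using (↣-id)
open import Function.Construct.Symmetry using (⤖-sym)
open import Data.Nat using (ℕ; zero; suc)
open import Data.Product using (Σ; _,_; proj₁; proj₂)
open import Relation.Binary.PropositionalEquality using (_≡_; refl; cong; sym; trans)
open import Relation.Unary using (Pred; _⊆_)
open import Relation.Nullary using (Irrelevant)

private
  variable
    a b x ℓ : Level
    A : Set a
    B : Set b
    X : Set x

Fiber : {A : Set a} {X : Set x} → (A → X) → Pred X (a ⊔ x)
Fiber {A = A} h y = Σ A λ a → h a ≡ y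

Σ-Fiber⤖ : (h : A → X) → Σ X (Fiber h) ⤖ A
Σ-Fiber⤖ h = ↔⇒⤖ (mk↔ₛ′ (proj₁ ∘ proj₂) (λ a → h a , a , refl)
                         (λ _ → refl) (λ { (_ , _ , refl) → refl }))

Fiber-irrelevant : (h : A ↣ X) (x : X) → Irrelevant (Fiber (Injection.to h) x)
Fiber-irrelevant h x (a , p) (b , q) with Injection.injective h (trans p (sym q))
Fiber-irrelevant h x (a , refl) (.a , refl) | refl = refl

Fiber-∘-⊆ : (h : B → X) (f : A → B) → Fiber (h ∘ f) ⊆ Fiber h
Fiber-∘-⊆ h f (a , p) = f a , p

Σ-⊆-↣ : {P Q : Pred X ℓ} → (∀ x → Irrelevant (P x)) → P ⊆ Q → Σ X P ↣ Σ X Q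
Σ-⊆-↣ {X = X} {P = P} {Q = Q} irr P⊆Q = mk↣ injective
  where
  inclusion : Σ X P → Σ X Q
  inclusion (x , p) = x , P⊆Q p

  injective : ∀ {u v} → inclusion u ≡ inclusion v → u ≡ v
  injective {x , p} {y , q} e with cong proj₁ e
  ... | refl = cong (x ,_) (irr x p q)

embedInitial : {A : ℕ → Set ℓ} → (∀ n → A (suc n) ↣ A n) → ∀ n → A n ↣ A 0
embedInitial {A = A} f zero    = ↣-id (A 0)
embedInitial         f (suc n) = embedInitial f n ↣-∘ f n

principle1⇒principle2 : Principle1 ℓ → Principle2 ℓ
principle1⇒principle2 P1 X B irr B⊆ =
  P1 (λ n → Σ X (B n)) (λ n → Σ-⊆-↣ (irr (suc n)) (B⊆ n))

principle2⇒principle1 : Principle2 ℓ → Principle1 ℓ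
principle2⇒principle1 {ℓ} P2 A f =
  let k , image⤖ = P2 (A 0) image image-irrelevant image-decreasing
  in  k , Σ-Fiber⤖ _ ⤖-∘ (image⤖ ⤖-∘ ⤖-sym (Σ-Fiber⤖ _))
  where
  embed : ∀ n → A n ↣ A 0
  embed = embedInitial f

  image : ℕ → Pred (A 0) ℓ
  image n = Fiber (Injection.to (embed n))

  image-irrelevant : ∀ n x → Irrelevant (image n x)
  image-irrelevant n = Fiber-irrelevant (embed n)

  image-decreasing : ∀ n → image (suc n) ⊆ image n
  image-decreasing n = Fiber-∘-⊆ (Injection.to (embed n)) (Injection.to (f n))

proposition4p4 : ∀ {ℓ : Level} → Principle1 ℓ ⇔ Principle2 ℓ
proposition4p4 = mk⇔ principle1⇒principle2 principle2⇒principle1
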